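{- Let $n$ be a perfect square and let $$f = \bigvee_{i=0}^{\sqrt n -1}{\rm Parity}_{\sqrt n}(x_{\sqrt n \cdot i + 1}, x_{\sqrt n \cdot i + 2}, \ldots, x_{\sqrt n \cdot i + \sqrt n}).$$ Then $size^{\rm ndc}(f) \leq 2n + o(n)$.
   Context: ${\rm Parity}_m(x_1,\dots,x_m)=1$ iff $\sum x_i\equiv 1 \pmod 2$. $U_2$ is the set of Boolean functions of the form $((x\oplus a)\wedge(y\oplus b))\oplus c$, $a,b,c\in\{0,1\}$ (all two-variable functions except XOR and its complement). A $U_2$-circuit has fan-in-2 gates labeled by functions in $U_2$; its size is the number of gates. A nondeterministic circuit has actual inputs $x_1,\dots,x_n$ and additional guess inputs, and computes $f$ with $f(x)=1$ iff some setting of the guess inputs makes the output 1. $size^{\rm ndc}(f)$ is the size of the smallest nondeterministic $U_2$-circuit computing $f$. -}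

module Defs where

open import Data.Nat using (ℕ; zero; suc; _+_; _*_; _≤_)
open import Data.Bool using (Bool; true; false; _xor_; _∧_; _∨_)
open import Data.Fin using (Fin; combine)
open import Data.Vec using (Vec; _∷_; lookup; tabulate)
open import Data.Vec.Functional using (_++_; foldr)
open import Data.Product using (Σ; ∃; _×_; _,_)
open import Function.Bundles using (_⇔_)
open import Relation.Binary.PropositionalEquality using (_≡_)

record U2 : Set where
  constructor u2
  field a b c : Bool

applyU2 : U2 → Bool → Bool → Bool
applyU2 (u2 a b c) x y = ((x xor a) ∧ (y xor b)) xor c

record Gate (t : ℕ) : Set where
  constructor gate
  field
    op   : U2
    inl  : Fin t
    inr  : Fin t

-- A U₂-circuit on m input variables with s gates (a topologically ordered
-- list of gates; each gate reads any two earlier nodes: inputs or gates).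
data Circuit (m : ℕ) : ℕ → Set where
  []  : Circuit m 0
  _▷_ : ∀ {s} → Circuit m s → Gate (s + m) → Circuit m (suc s)

-- Values of all nodes (newest gate first, then the m inputs).
evalAll : ∀ {m s} → Circuit m s → (Fin m → Bool) → Vec Bool (s + m)
evalAll [] x = tabulate x
evalAll (C ▷ gate op l r) x =
  let v = evalAll C x in applyU2 op (lookup v l) (lookup v r) ∷ v

record NDCircuit (n : ℕ) : Set where
  field
    guesses : ℕ
    size    : ℕ
    circ    : Circuit (n + guesses) size
    out     : Fin (size + (n + guesses))

open NDCircuit public

runND : ∀ {n} (C : NDCircuit n) → (Fin n → Bool) → (Fin (guesses C) → Bool) → Bool
runND C x y = lookup (evalAll (circ C) (x ++ y)) (out C)

Computes : ∀ {n} → NDCircuit n → ((Fin n → Bool) → Bool) → Set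
Computes {n} C f = ∀ (x : Fin n → Bool) →
  (f x ≡ true) ⇔ (∃ λ (y : Fin (guesses C) → Bool) → runND C x y ≡ true)

SizeNDC≤ : ∀ {n} → ((Fin n → Bool) → Bool) → ℕ → Set
SizeNDC≤ {n} f s = Σ (NDCircuit n) λ C → Computes C f × size C ≤ s

parity : ∀ {m} → (Fin m → Bool) → Bool
parity = foldr _xor_ false

bigOr : ∀ {m} → (Fin m → Bool) → Bool
bigOr = foldr _∨_ false

-- For n = k², f = OR_{i<k} Parity_k(x_{k i + 1}, …, x_{k i + k}).
-- Variable x_{k i + j + 1} (0-based index k·i + j) is combine i j.
orOfParities : (k : ℕ) → (Fin (k * k) → Bool) → Bool
orOfParities k x = bigOr λ (i : Fin k) → parity λ (j : Fin k) → x (combine i j)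

module Submission where

-- Guess the block to be checked as a one-hot vector y ∈ {0,1}^k. Column j of the selected block is
-- ⋁ᵢ (x_{ij} ∧ yᵢ), which costs k AND and k OR gates, and the parity of the k columns costs three
-- gates per XOR, so 2k² + O(k) gates in total. It only remains to reject guesses with two or more
-- ones (they would OR several blocks together), and that check costs O(k) gates.

open import Defs
open import Data.Nat using (ℕ; zero; suc; _+_; _*_; _≤_; z≤n; s≤s)
open import Data.Nat.Properties
  using ( ≤-refl; ≤-trans; ≤-reflexive; +-monoʳ-≤; +-monoˡ-≤; *-monoʳ-≤; *-monoˡ-≤; +-identityʳ
        ; module ≤-Reasoning)
open import Data.Nat.Tactic.RingSolver using (solve-∀)
open import Data.Bool using (Bool; true; false; _xor_; _∧_; _∨_; not)
open import Data.Bool.Properties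
  using (∧-conicalˡ; ∧-conicalʳ; ∨-conicalʳ; ∧-identityʳ; ∧-inverseʳ; not-injective; xor-is-ok)
open import Data.Fin using (Fin; zero; suc; combine; _↑ˡ_; _↑ʳ_; _≟_)
open import Data.Fin.Properties using (suc-injective)
open import Data.Vec using (lookup)
open import Data.Vec.Properties using (lookup∘tabulate)
open import Data.Vec.Functional using (_++_; foldr; head; tail)
open import Data.Vec.Functional.Properties using (lookup-++ˡ; lookup-++ʳ)
open import Data.Vec.Functional.Relation.Binary.Pointwise.Properties using (foldr-cong)
open import Data.Product using (∃; ∃-syntax; _×_; _,_; map₂)
open import Function.Bundles using (_⇔_; mk⇔; Equivalence)
open import Relation.Nullary using (does; yes)
open import Relation.Nullary.Decidable using (dec-true)
open import Relation.Binary.PropositionalEquality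

bigOr≡true⇒∃ : ∀ {t} (v : Fin t → Bool) → bigOr v ≡ true → ∃[ i ] v i ≡ true
bigOr≡true⇒∃ {suc t} v h with v zero in e
... | true  = zero , e
... | false with bigOr≡true⇒∃ (tail v) h
...   | i , p = suc i , p

∃⇒bigOr≡true : ∀ {t} (v : Fin t → Bool) i → v i ≡ true → bigOr v ≡ true
∃⇒bigOr≡true v zero    p rewrite p = refl
∃⇒bigOr≡true v (suc i) p with v zero
... | true  = refl
... | false = ∃⇒bigOr≡true (tail v) i p

parity≡true⇒∃ : ∀ {t} (v : Fin t → Bool) → parity v ≡ true → ∃[ i ] v i ≡ true
parity≡true⇒∃ {suc t} v h with v zero in e
... | true  = zero , e
... | false with parity≡true⇒∃ (tail v) h
...   | i , p = suc i , p

bigOr-single : ∀ {t} (v : Fin t → Bool) i₀ → (∀ {i} → v i ≡ true → i ≡ i₀) → bigOr v ≡ v i₀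
bigOr-single v i₀ only with v i₀ in e
... | true = ∃⇒bigOr≡true v i₀ e
... | false with bigOr v in b
...   | false = refl
...   | true with bigOr≡true⇒∃ v b
...     | i , p with refl ← only p with () ← trans (sym e) p

AtMostOne : ∀ {t} → (Fin t → Bool) → Set
AtMostOne y = ∀ {i j} → y i ≡ true → y j ≡ true → i ≡ j

bigOr-∧-select : ∀ {t} (a y : Fin t → Bool) {i₀} → AtMostOne y → y i₀ ≡ true →
                 bigOr (λ i → a i ∧ y i) ≡ a i₀
bigOr-∧-select a y {i₀} unique yi₀ = begin
  bigOr (λ i → a i ∧ y i) ≡⟨ bigOr-single _ i₀ (λ p → unique (∧-conicalʳ _ _ p) yi₀) ⟩
  a i₀ ∧ y i₀             ≡⟨ cong (a i₀ ∧_) yi₀ ⟩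
  a i₀ ∧ true             ≡⟨ ∧-identityʳ (a i₀) ⟩
  a i₀                    ∎
  where open ≡-Reasoning

atLeastTwo : ∀ {t} → (Fin t → Bool) → Bool
atLeastTwo {zero}  y = false
atLeastTwo {suc t} y = (head y ∧ bigOr (tail y)) ∨ atLeastTwo (tail y)

atLeastTwo≡false⇒AtMostOne : ∀ {t} (y : Fin t → Bool) → atLeastTwo y ≡ false → AtMostOne y
atLeastTwo≡false⇒AtMostOne y h {zero} {zero} p q = refl
atLeastTwo≡false⇒AtMostOne y h {zero} {suc j} p q
  rewrite p | ∃⇒bigOr≡true (tail y) j q with () ← h
atLeastTwo≡false⇒AtMostOne y h {suc i} {zero} p q
  rewrite q | ∃⇒bigOr≡true (tail y) i p with () ← h
atLeastTwo≡false⇒AtMostOne y h {suc i} {suc j} p q =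
  cong suc (atLeastTwo≡false⇒AtMostOne (tail y) (∨-conicalʳ _ _ h) p q)

AtMostOne⇒atLeastTwo≡false : ∀ {t} (y : Fin t → Bool) → AtMostOne y → atLeastTwo y ≡ false
AtMostOne⇒atLeastTwo≡false {zero}  y unique = refl
AtMostOne⇒atLeastTwo≡false {suc t} y unique =
  cong₂ _∨_ noPair (AtMostOne⇒atLeastTwo≡false (tail y) λ p q → suc-injective (unique p q))
  where
  noPair : head y ∧ bigOr (tail y) ≡ false
  noPair with head y in e₀ | bigOr (tail y) in e₁
  ... | false | _     = refl
  ... | true  | false = refl
  ... | true  | true with bigOr≡true⇒∃ (tail y) e₁
  ...   | i , p with () ← unique e₀ p

indicator : ∀ {t} → Fin t → Fin t → Bool
indicator i₀ i = does (i ≟ i₀)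

indicator-AtMostOne : ∀ {t} (i₀ : Fin t) → AtMostOne (indicator i₀)
indicator-AtMostOne i₀ {i} {j} p q = trans (at p) (sym (at q))
  where
  at : ∀ {i} → indicator i₀ i ≡ true → i ≡ i₀
  at {i} _ with yes i≡i₀ ← i ≟ i₀ = i≡i₀

verifier : ∀ k → (Fin (k * k) → Bool) → (Fin k → Bool) → Bool
verifier k x y = parity (λ j → bigOr (λ i → x (combine i j) ∧ y i)) ∧ not (atLeastTwo y)

selected-parity : ∀ k (x : Fin (k * k) → Bool) (y : Fin k → Bool) {i₀} → AtMostOne y → y i₀ ≡ true →
                  parity (λ j → bigOr (λ i → x (combine i j) ∧ y i)) ≡ parity (λ j → x (combine i₀ j))
selected-parity k x y unique yi₀ =
  foldr-cong {R = _≡_} {S = _≡_} {f = _xor_} {g = _xor_} (cong₂ _xor_) refl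
    λ j → bigOr-∧-select (λ i → x (combine i j)) y unique yi₀

orOfParities⇔∃verifier : ∀ k x → (orOfParities k x ≡ true) ⇔ (∃[ y ] verifier k x y ≡ true)
orOfParities⇔∃verifier k x = mk⇔ complete sound
  where
  blockParity : Fin k → Bool
  blockParity i = parity (λ j → x (combine i j))

  complete : orOfParities k x ≡ true → ∃[ y ] verifier k x y ≡ true
  complete h with bigOr≡true⇒∃ blockParity h
  ... | i₀ , odd = indicator i₀ , cong₂ (λ p c → p ∧ not c)
    (trans (selected-parity k x (indicator i₀) (indicator-AtMostOne i₀) (dec-true (i₀ ≟ i₀) refl)) odd)
    (AtMostOne⇒atLeastTwo≡false (indicator i₀) (indicator-AtMostOne i₀))

  sound : ∃[ y ] verifier k x y ≡ true → orOfParities k x ≡ true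
  sound (y , h) with parity≡true⇒∃ (λ j → bigOr (λ i → x (combine i j) ∧ y i)) (∧-conicalˡ _ _ h)
  ... | j , selected with bigOr≡true⇒∃ (λ i → x (combine i j) ∧ y i) selected
  ...   | i₀ , xy = ∃⇒bigOr≡true blockParity i₀
    (trans (sym (selected-parity k x y unique (∧-conicalʳ _ _ xy))) (∧-conicalˡ _ _ h))
    where
    unique : AtMostOne y
    unique = atLeastTwo≡false⇒AtMostOne y (not-injective {y = false} (∧-conicalʳ _ _ h))

and-gate or-gate andNot-gate : U2
and-gate    = u2 false false false
or-gate     = u2 true true true
andNot-gate = u2 false true false

applyU2-and : ∀ u v → applyU2 and-gate u v ≡ u ∧ v
applyU2-and false _     = refl
applyU2-and true  false = refl
applyU2-and true  true  = refl

applyU2-or : ∀ u v → applyU2 or-gate u v ≡ u ∨ v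
applyU2-or false false = refl
applyU2-or false true  = refl
applyU2-or true  _     = refl

applyU2-andNot : ∀ u v → applyU2 andNot-gate u v ≡ u ∧ not v
applyU2-andNot false _     = refl
applyU2-andNot true  false = refl
applyU2-andNot true  true  = refl

lookup-input : ∀ {m s} (C : Circuit m s) z j → lookup (evalAll C z) (s ↑ʳ j) ≡ z j
lookup-input []      z j = lookup∘tabulate z j
lookup-input (C ▷ _) z j = lookup-input C z j

module Construction (n g : ℕ) where

  Semantics : Set
  Semantics = (Fin n → Bool) → (Fin g → Bool) → Bool

  record Node (A : Semantics) {s} (C : Circuit (n + g) s) : Set where
    constructor node
    field
      wire     : Fin (s + (n + g))
      computes : ∀ x y → lookup (evalAll C (x ++ y)) wire ≡ A x y

  Input : Semantics → Set
  Input A = ∀ {s} {C : Circuit (n + g) s} → Node A C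

  actual : (i : Fin n) → Input (λ x y → x i)
  actual i {s} {C} = node (s ↑ʳ (i ↑ˡ g)) λ x y →
    trans (lookup-input C (x ++ y) (i ↑ˡ g)) (lookup-++ˡ x y i)

  guess : (i : Fin g) → Input (λ x y → y i)
  guess i {s} {C} = node (s ↑ʳ (n ↑ʳ i)) λ x y →
    trans (lookup-input C (x ++ y) (n ↑ʳ i)) (lookup-++ʳ x y i)

  record Extension {s} (C : Circuit (n + g) s) (c : ℕ) : Set where
    constructor mkExtension
    field
      {gates} : ℕ
      circuit : Circuit (n + g) gates
      gates-≤ : gates ≤ c + s
      lift    : ∀ {A} → Node A C → Node A circuit
  open Extension public

  _⨾_ : ∀ {s c₁ c₂} {C : Circuit (n + g) s} (E₁ : Extension C c₁) → Extension (circuit E₁) c₂ →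
        Extension C (c₁ + c₂)
  _⨾_ {s} {c₁} {c₂} E₁ E₂ = mkExtension (circuit E₂) gates₂-≤ (λ a → lift E₂ (lift E₁ a))
    where
    open ≤-Reasoning
    gates₂-≤ : gates E₂ ≤ c₁ + c₂ + s
    gates₂-≤ = begin
      gates E₂            ≤⟨ gates-≤ E₂ ⟩
      c₂ + gates E₁       ≤⟨ +-monoʳ-≤ c₂ (gates-≤ E₁) ⟩
      c₂ + (c₁ + s)       ≡⟨ reassociate c₁ c₂ s ⟩
      c₁ + c₂ + s         ∎
      where
      reassociate : ∀ a b c → b + (a + c) ≡ a + b + c
      reassociate = solve-∀

  CircuitPred : Set₁
  CircuitPred = ∀ {s} → Circuit (n + g) s → Set

  record Builds {s} (C : Circuit (n + g) s) (c : ℕ) (P : CircuitPred) : Set where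
    constructor built
    field
      extension : Extension C c
      result    : P (circuit extension)
  open Builds public

  return : ∀ {s} {C : Circuit (n + g) s} {P : CircuitPred} → P C → Builds C 0 P
  return {C = C} p = built (mkExtension C ≤-refl (λ a → a)) p

  _>>=_ : ∀ {s c₁ c₂} {C : Circuit (n + g) s} {P Q : CircuitPred} (b : Builds C c₁ P) →
          ((b : Builds C c₁ P) → Builds (circuit (extension b)) c₂ Q) → Builds C (c₁ + c₂) Q
  b >>= k = built (extension b ⨾ extension (k b)) (result (k b))

  weaken : ∀ {s c c′} {C : Circuit (n + g) s} {P : CircuitPred} → c ≤ c′ → Builds C c P → Builds C c′ P
  weaken {s} c≤c′ (built (mkExtension C′ gates-≤ lift) p) =
    built (mkExtension C′ (≤-trans gates-≤ (+-monoˡ-≤ s c≤c′)) lift) p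

  gate-node : ∀ {s} {C : Circuit (n + g) s} {A B R : Semantics} op → Node A C → Node B C →
              (∀ x y → applyU2 op (A x y) (B x y) ≡ R x y) → Builds C 1 (Node R)
  gate-node {C = C} op (node l l-ok) (node r r-ok) spec =
    built (mkExtension (C ▷ gate op l r) ≤-refl λ (node w ok) → node (suc w) ok)
          (node zero λ x y → trans (cong₂ (applyU2 op) (l-ok x y) (r-ok x y)) (spec x y))

  BinaryBuilder : ℕ → (Bool → Bool → Bool) → Set
  BinaryBuilder c h = ∀ {s} {C : Circuit (n + g) s} {A B} → Node A C → Node B C →
                      Builds C c (Node (λ x y → h (A x y) (B x y)))

  and-node : BinaryBuilder 1 _∧_
  and-node {A = A} {B} a b = gate-node and-gate a b λ x y → applyU2-and (A x y) (B x y)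

  or-node : BinaryBuilder 1 _∨_
  or-node {A = A} {B} a b = gate-node or-gate a b λ x y → applyU2-or (A x y) (B x y)

  andNot-node : BinaryBuilder 1 (λ u v → u ∧ not v)
  andNot-node {A = A} {B} a b = gate-node andNot-gate a b λ x y → applyU2-andNot (A x y) (B x y)

  xor-node : BinaryBuilder 3 _xor_
  xor-node {A = A} {B} a b = do
    built E₁ a∨b ← or-node a b
    built E₂ a∧b ← and-node (lift E₁ a) (lift E₁ b)
    gate-node andNot-gate (lift E₂ a∨b) a∧b λ x y →
      trans (applyU2-andNot (A x y ∨ B x y) (A x y ∧ B x y)) (sym (xor-is-ok (A x y) (B x y)))

  Builder : ℕ → Semantics → Set
  Builder c A = ∀ {s} (C : Circuit (n + g) s) → Builds C c (Node A)

  false-builder : ∀ {A} → Input A → Builder 1 (λ _ _ → false)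
  false-builder {A} a C = gate-node andNot-gate a a λ x y →
    trans (applyU2-andNot (A x y) (A x y)) (∧-inverseʳ (A x y))

  zipWith-builder : ∀ {c c₁ c₂ h A B} → BinaryBuilder c h → Builder c₁ A → Builder c₂ B →
                    Builder (c₁ + (c₂ + c)) (λ x y → h (A x y) (B x y))
  zipWith-builder op a b C = do
    built E₁ u ← a C
    built E₂ v ← b (circuit E₁)
    op (lift E₂ u) v

  foldr-builder : ∀ {c d d′ t h E} {V : Fin t → Semantics} → BinaryBuilder c h → Builder d E →
                  ((i : Fin t) → Builder d′ (V i)) →
                  Builder (t * (d′ + c) + d) (λ x y → foldr h (E x y) (λ i → V i x y))
  foldr-builder {t = zero}  op e v C = e C
  foldr-builder {c} {d} {d′} {suc t} {h} op e v C =
    weaken (≤-reflexive (cost d′ c t d))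
      (zipWith-builder {h = h} op (v zero) (foldr-builder {h = h} op e (λ i → v (suc i))) C)
    where
    cost : ∀ d′ c t d → d′ + (t * (d′ + c) + d + c) ≡ suc t * (d′ + c) + d
    cost = solve-∀

  bigOr-atLeastTwo-builder : ∀ {t d} {V : Fin t → Semantics} → Builder d (λ _ _ → false) →
    ((i : Fin t) → Input (V i)) → ∀ {s} (C : Circuit (n + g) s) → Builds C (t * 3 + d) λ C′ →
      Node (λ x y → bigOr (λ i → V i x y)) C′ × Node (λ x y → atLeastTwo (λ i → V i x y)) C′
  bigOr-atLeastTwo-builder {zero} {d} constFalse v C = weaken (≤-reflexive (+-identityʳ d)) do
    built _ falseNode ← constFalse C
    return (falseNode , falseNode)
  bigOr-atLeastTwo-builder {suc t} {d} constFalse v C = weaken (≤-reflexive (cost t d)) do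
    built E₁ (any , two) ← bigOr-atLeastTwo-builder constFalse (λ i → v (suc i)) C
    built E₂ pair ← and-node (v zero) any
    built E₃ two′ ← or-node pair (lift E₂ two)
    built E₄ any′ ← or-node (v zero) (lift E₃ (lift E₂ any))
    return (any′ , lift E₄ two′)
    where
    cost : ∀ t d → t * 3 + d + (1 + (1 + (1 + 0))) ≡ suc t * 3 + d
    cost = solve-∀

  sizeNDC≤-from-node : ∀ {s} {C : Circuit (n + g) s} {A} {f : (Fin n → Bool) → Bool} → Node A C →
                       (∀ x → (f x ≡ true) ⇔ (∃[ y ] A x y ≡ true)) → SizeNDC≤ f s
  sizeNDC≤-from-node {s} {C} {f = f} (node w ok) f⇔∃A =
    circuit′ , computes , ≤-refl
    where
    circuit′ : NDCircuit n
    circuit′ = record { guesses = g ; size = s ; circ = C ; out = w }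
    computes : Computes circuit′ f
    computes x = mk⇔
      (λ fx → map₂ (λ {y} Axy → trans (ok x y) Axy) (Equivalence.to (f⇔∃A x) fx))
      (λ (y , run) → Equivalence.from (f⇔∃A x) (y , trans (sym (ok x y)) run))

verifierCost : ℕ → ℕ
verifierCost k = 2 * (k * k) + 7 * k + 3

verifier-builder : ∀ k → Fin k → Construction.Builder (k * k) k (verifierCost k) (verifier k)
verifier-builder k i₀ C = weaken (≤-reflexive (cost k)) do
    built E₁ par ← parity-builder C
    built E₂ (_ , two) ← bigOr-atLeastTwo-builder constFalse guess (circuit E₁)
    andNot-node (lift E₂ par) two
  where
  open Construction (k * k) k
  constFalse : Builder 1 (λ _ _ → false)
  constFalse = false-builder (guess i₀)
  column : (j : Fin k) → Builder (k * (1 + 1) + 1) (λ x y → bigOr (λ i → x (combine i j) ∧ y i))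
  column j = foldr-builder {h = _∨_} or-node constFalse
               λ i C → and-node (actual (combine i j)) (guess i)
  parity-builder : Builder (k * ((k * (1 + 1) + 1) + 3) + 1)
                     (λ x y → parity (λ j → bigOr (λ i → x (combine i j) ∧ y i)))
  parity-builder = foldr-builder {h = _xor_} xor-node constFalse column
  cost : ∀ t → t * ((t * (1 + 1) + 1) + 3) + 1 + (t * 3 + 1 + 1) ≡ 2 * (t * t) + 7 * t + 3
  cost = solve-∀

verifierCost-bound : ∀ M k → 10 * M ≤ suc k → M * verifierCost (suc k) ≤ (2 * M + 1) * (suc k * suc k)
verifierCost-bound M k 10M≤K = begin
  M * (2 * (K * K) + 7 * K + 3)      ≡⟨ split M K ⟩
  2 * M * (K * K) + M * (7 * K + 3)  ≤⟨ +-monoʳ-≤ (2 * M * (K * K)) (*-monoʳ-≤ M linear≤10K) ⟩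
  2 * M * (K * K) + M * (10 * K)     ≡⟨ cong (2 * M * (K * K) +_) (swap M K) ⟩
  2 * M * (K * K) + 10 * M * K       ≤⟨ +-monoʳ-≤ (2 * M * (K * K)) (*-monoˡ-≤ K 10M≤K) ⟩
  2 * M * (K * K) + K * K            ≡⟨ merge M K ⟩
  (2 * M + 1) * (K * K)              ∎
  where
  open ≤-Reasoning
  K : ℕ
  K = suc k
  linear≤10K : 7 * K + 3 ≤ 10 * K
  linear≤10K = ≤-trans (+-monoʳ-≤ (7 * K) (*-monoʳ-≤ 3 (s≤s (z≤n {k})))) (≤-reflexive (collect K))
    where
    collect : ∀ K → 7 * K + 3 * K ≡ 10 * K
    collect = solve-∀
  split : ∀ M K → M * (2 * (K * K) + 7 * K + 3) ≡ 2 * M * (K * K) + M * (7 * K + 3)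
  split = solve-∀
  swap : ∀ M K → M * (10 * K) ≡ 10 * M * K
  swap = solve-∀
  merge : ∀ M K → 2 * M * (K * K) + K * K ≡ (2 * M + 1) * (K * K)
  merge = solve-∀

lemma2 : ∀ (m : ℕ) → ∃ λ (K : ℕ) → ∀ (k : ℕ) → K ≤ k →
    ∃ λ (s : ℕ) → SizeNDC≤ (orOfParities k) s ×
      suc m * s ≤ (2 * suc m + 1) * (k * k)
lemma2 m = 10 * suc m , bound
  where
  bound : ∀ k → 10 * suc m ≤ k →
          ∃ λ s → SizeNDC≤ (orOfParities k) s × suc m * s ≤ (2 * suc m + 1) * (k * k)
  bound zero    ()
  bound (suc k) 10M≤k =
    gates (extension b) , sizeNDC≤-from-node (result b) (orOfParities⇔∃verifier (suc k)) ,
    ≤-trans (*-monoʳ-≤ (suc m) gates≤cost) (verifierCost-bound (suc m) k 10M≤k)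
    where
    open Construction (suc k * suc k) (suc k)
    b : Builds [] (verifierCost (suc k)) (Node (verifier (suc k)))
    b = verifier-builder (suc k) zero []
    gates≤cost : gates (extension b) ≤ verifierCost (suc k)
    gates≤cost = ≤-trans (gates-≤ (extension b)) (≤-reflexive (+-identityʳ _))
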